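{- For every name $P$: if $\eta\,P\,\mathit{Region}$, then there exists $C$ with $\eta\,C\,\mathit{balls}$ and $\eta\,C\,(pt\,P)$.
   Context: Setting: a Coq formalization (classical logic) of Leśniewski's Ontology and Mereology. Names form a type $N$ with a primitive relation $\eta:N\to N\to\mathrm{Prop}$ satisfying Leśniewski's ontological axiom $\eta\,A\,b \leftrightarrow ((\exists C,\eta\,C\,A)\wedge(\forall C\,D,\eta\,C\,A\wedge\eta\,D\,A\to\eta\,C\,D)\wedge(\forall C,\eta\,C\,A\to\eta\,C\,b))$; $A$ is an individual iff $\eta\,A\,A$; $a\subseteq b$ means $\forall P,\eta\,P\,a\to\eta\,P\,b$. Mereology: $pt:N\to N$ ($\eta\,B\,(pt\,A)$: $B$ is a part of $A$) satisfying Leśniewski's mereology axioms (part-of a partial order on individuals; every non-empty name has a unique m-class). M-class: $\eta\,A\,(klass\,a)$ iff $\eta\,A\,A$, $\forall B,\eta\,B\,a\to\eta\,B\,(pt\,A)$, and $\forall B,\eta\,B\,(pt\,A)\to\exists C\,D,\eta\,C\,a\wedge\eta\,D\,(pt\,C)\wedge\eta\,D\,(pt\,B)$. $\mathit{balls}$ is a primitive name (there exists at least one ball). Region: $\eta\,P\,\mathit{Region}$ iff $\eta\,P\,P$ and $\exists b,\ b\subseteq\mathit{balls}\wedge\eta\,P\,(klass\,b)$. -}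

module Defs where

open import Level using (Level; suc; _⊔_)
open import Data.Product using (Σ; ∃; _×_; _,_)
open import Relation.Nullary using (¬_)
open import Data.Sum using (_⊎_)
open import Function.Bundles using (_⇔_)

-- A model of Leśniewski's Ontology + Mereology, with the primitive name
-- `balls` and the defined name `Region`, in a classical setting.
record Mereology (ℓ : Level) : Set (suc ℓ) where
  field
    N : Set ℓ
    η : N → N → Set ℓ
    lem : ∀ (A : Set ℓ) → A ⊎ ¬ A
    ontology : ∀ A b →
      η A b ⇔ ((∃ λ C → η C A)
               × (∀ C D → η C A → η D A → η C D)
               × (∀ C → η C A → η C b))

  _⊆_ : N → N → Set ℓ
  a ⊆ b = ∀ P → η P a → η P b

  field
    pt : N → N
    klass : N → N
    klass-def : ∀ A a →
      η A (klass a) ⇔ (η A A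
                       × (∀ B → η B a → η B (pt A))
                       × (∀ B → η B (pt A) →
                            ∃ λ C → ∃ λ D → η C a × η D (pt C) × η D (pt B)))
    pt-ind : ∀ A B → η B (pt A) → η B B × η A A
    pt-refl : ∀ A → η A A → η A (pt A)
    pt-antisym : ∀ A B → η A (pt B) → η B (pt A) → η A B
    pt-trans : ∀ A B C → η A (pt B) → η B (pt C) → η A (pt C)
    klass-exists : ∀ a → (∃ λ A → η A a) → ∃ λ A → η A (klass a)
    klass-unique : ∀ a A B → η A (klass a) → η B (klass a) → η A B
    balls : N
    balls-nonempty : ∃ λ B → η B balls
    Region : N
    Region-def : ∀ P →
      η P Region ⇔ (η P P × ∃ λ b → (b ⊆ balls) × η P (klass b))

-- A region P is the m-class of some name b of balls. That name is non-empty
-- (the covering clause of the m-class, applied to P as a part of itself,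
-- yields an element of b), and every element of b is a part of its class P.
module Submission where

open import Defs
open import Level using (Level)
open import Data.Product using (∃; _×_; _,_; proj₁; proj₂)
open import Function.Bundles using (Equivalence)

module _ {ℓ : Level} (M : Mereology ℓ) where
  open Mereology M

  klass-individual : ∀ {A a} → η A (klass a) → η A A
  klass-individual A∈klass = proj₁ (Equivalence.to (klass-def _ _) A∈klass)

  klass-upper-bound : ∀ {A a B} → η A (klass a) → η B a → η B (pt A)
  klass-upper-bound A∈klass = proj₁ (proj₂ (Equivalence.to (klass-def _ _) A∈klass)) _

  klass-nonempty : ∀ {A a} → η A (klass a) → ∃ λ C → η C a
  klass-nonempty {A} A∈klass
    with proj₂ (proj₂ (Equivalence.to (klass-def _ _) A∈klass)) A
           (pt-refl A (klass-individual A∈klass))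
  ... | C , _ , C∈a , _ = C , C∈a

  Region-klass-of-balls : ∀ {P} → η P Region → ∃ λ b → (b ⊆ balls) × η P (klass b)
  Region-klass-of-balls P∈Region = proj₂ (Equivalence.to (Region-def _) P∈Region)

lemma8 : ∀ {ℓ} (M : Mereology ℓ) → let open Mereology M in
    ∀ P → η P Region → ∃ λ C → η C balls × η C (pt P)
lemma8 M P P∈Region with Region-klass-of-balls M P∈Region
... | b , b⊆balls , P∈klass with klass-nonempty M P∈klass
... | C , C∈b = C , b⊆balls C C∈b , klass-upper-bound M P∈klass C∈b
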